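{- Let $n=p_1^{n_1}\cdots p_r^{n_r}$ with primes $p_1<\cdots<p_r$ and positive integers $n_i$. Let $I_1$ be a nonempty proper subset of $[r]$, $a\in[r]\setminus I_1$ and $I_2=[r]\setminus(I_1\cup\{a\})$. If $K$ is the union of the subgroups $S_{n/(p_ip_a)}$ of $C_n$ for $i\in I_1$, then $$|K|=\frac{n}{p_1\cdots p_r}\cdot\prod_{j\in I_2}p_j\cdot\left[\prod_{i\in I_1}p_i-\phi\!\left(\prod_{i\in I_1}p_i\right)\right],$$ where $\prod_{j\in I_2}p_j=1$ if $I_2=\emptyset$.
   Context: $\phi$ is Euler's totient function; $C_n$ is the cyclic group of order $n$; $S_d$ is the unique subgroup of $C_n$ of order $d$; $[m]=\{1,\dots,m\}$. -}

module Defs where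

open import Data.Nat using (ℕ; zero; suc; _/_; _≟_)
open import Data.Nat.Divisibility using (_∣?_)
open import Data.Nat.GCD using (gcd)
open import Data.Fin using (Fin; toℕ)
open import Data.Fin.Subset using (Subset; ⋃)
open import Data.Fin.Subset.Properties using (_∈?_)
open import Data.Nat.ListAction using (product)
open import Data.List using (filter; map; length; allFin)
open import Data.Vec using (tabulate)
open import Relation.Nullary using (does)

-- Natural-number division with the (never used) convention m div 0 = 0.
-- All divisions in the statement are exact divisions by positive numbers.
_div_ : ℕ → ℕ → ℕ
m div zero    = 0
m div (suc k) = m / suc k

φ : ℕ → ℕ
φ m = length (filter (λ (k : Fin m) → gcd (suc (toℕ k)) m ≟ 1) (allFin m))

-- The cyclic group C_n is modelled as ℤ/nℤ with carrier Fin n = {0,…,n-1}.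
-- S n d : the subgroup of C_n generated by n/d, i.e. the multiples of n/d;
-- for d ∣ n this is the unique subgroup of C_n of order d.
S : (n d : ℕ) → Subset n
S n d = tabulate (λ x → does ((n div d) ∣? toℕ x))

∏[_∈_] : ∀ {r} → (Fin r → ℕ) → Subset r → ℕ
∏[ f ∈ I ] = product (map f (filter (_∈? I) (allFin _)))

⋃[_∈_] : ∀ {r n} → (Fin r → Subset n) → Subset r → Subset n
⋃[ A ∈ I ] = ⋃ (map A (filter (_∈? I) (allFin _)))

-- Put rad = p₁⋯p_r, M = ∏_{i∈I₁} p_i and P₂ = ∏_{j∈I₂} p_j, so that rad = M·p_a·P₂ divides n.
-- Since p_i·p_a divides n, the subgroup S_{n/(p_i p_a)} consists of the multiples of p_i·p_a, so
-- membership in K is periodic with period M·p_a, and [0, n) is (n/rad)·P₂ such periods.  Within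
-- one period only multiples z·p_a of p_a can lie in K, and z·p_a does exactly when some p_i with
-- i ∈ I₁ divides z, i.e. when z is not coprime to M; this leaves M − φ(M) elements per period.

module Submission where

open import Defs
open import Data.Fin.Base using (Fin; zero; suc; toℕ)
import Data.Fin
import Data.Nat
open import Data.Fin.Subset using (Subset; Nonempty; _⊂_; _∈_; _∉_; ⊤; ⊥; ∁; _∪_; ⁅_⁆; ∣_∣; ⋃; inside; outside)
open import Data.Fin.Subset.Properties
  using (_∈?_; drop-there; ∉⊥; ∈⊤; x∈p∪q⁻; x∈p∪q⁺; x∈⁅y⁆⇒x≡y; x∈∁p⇒x∉p; x∉p⇒x∈∁p)
open import Data.List.Base using (List; []; _∷_; map; filter; tabulate; allFin; length)
open import Data.List.Properties using (map-tabulate; filter-none)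
open import Data.List.Membership.Propositional.Properties using (∈-map⁺)
open import Data.List.Relation.Unary.All as All using (All)
import Data.List.Relation.Unary.All.Properties as All
open import Data.List.Relation.Unary.Any as Any using (Any; here; there; any?)
import Data.List.Relation.Unary.Any.Properties as Any
open import Data.Nat.GCD using (gcd)
open import Data.Nat.Base using (ℕ; zero; suc; _+_; _*_; _^_; _∸_; _<_; _≥_; z<s; s<s; NonZero; ≢-nonZero⁻¹)
open import Data.Nat.Properties
  using (_≟_; *-commutativeSemigroup; *-identityʳ; *-zeroʳ; *-comm; *-assoc; +-suc; +-comm; +-identityʳ;
         +-cancelˡ-≡; m+n∸n≡m; m^n≢0; <⇒≱)
open import Algebra.Properties.CommutativeSemigroup *-commutativeSemigroup using (x∙yz≈y∙xz)
open import Data.Nat.Divisibility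
open import Data.Nat.DivMod using (m*n/n≡m; m/n*n≡m)
open import Data.Nat.Coprimality using (Coprime; coprime?; coprime-divisor; coprime⇒gcd≡1; gcd≡1⇒coprime)
open import Data.Nat.Primality using (Prime; ¬prime[1]; prime⇒irreducible; prime⇒nonZero)
open import Data.Nat.ListAction using (product)
open import Data.Nat.ListAction.Properties using (∈⇒∣product; product≢0)
open import Data.Product.Base using (_,_)
open import Data.Sum.Base as Sum using (_⊎_; inj₁; inj₂; [_,_]′)
open import Data.Bool.Base using (true; false)
open import Data.Vec.Properties using ([]=⇒lookup; lookup⇒[]=; lookup∘tabulate)
open import Data.Vec.Base using (lookup)
import Data.Vec.Base as Vec
open import Level using (Level)
open import Function.Base using (_∘_; id)
open import Function.Bundles using (_⇔_; mk⇔; Equivalence)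
import Function.Properties.Equivalence as ⇔
open import Function.Related.Propositional using (equivalence; module EquationalReasoning)
open import Relation.Nullary using (Dec; yes; no; does; ¬_; contradiction)
open import Relation.Nullary.Decidable using (toSum)
open import Relation.Unary using (Pred; Decidable)
open import Relation.Binary.PropositionalEquality

open Equivalence using (to; from)

private
  variable
    ℓ ℓ′ : Level
    P Q : Pred ℕ ℓ

count : Decidable P → ℕ → ℕ
count P? zero = 0
count P? (suc m) with P? 0
... | yes _ = suc (count (P? ∘ suc) m)
... | no _  = count (P? ∘ suc) m

count-cong : (P? : Decidable P) (Q? : Decidable Q) →
             ∀ m → (∀ x → x < m → P x ⇔ Q x) → count P? m ≡ count Q? m
count-cong P? Q? zero    P⇔Q = refl
count-cong P? Q? (suc m) P⇔Q with P? 0 | Q? 0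
... | yes _  | yes _  = cong suc (count-cong (P? ∘ suc) (Q? ∘ suc) m (λ x → P⇔Q (suc x) ∘ s<s))
... | yes p  | no ¬q  = contradiction (to (P⇔Q 0 z<s) p) ¬q
... | no ¬p  | yes q  = contradiction (from (P⇔Q 0 z<s) q) ¬p
... | no _   | no _   = count-cong (P? ∘ suc) (Q? ∘ suc) m (λ x → P⇔Q (suc x) ∘ s<s)

count-1-cong : (P? : Decidable P) (Q? : Decidable Q) → P 0 ⇔ Q 0 → count P? 1 ≡ count Q? 1
count-1-cong P? Q? P0⇔Q0 = count-cong P? Q? 1 (λ { zero _ → P0⇔Q0 ; (suc _) (s<s ()) })

count-+ : (P? : Decidable P) → ∀ a b → count P? (a + b) ≡ count P? a + count (λ x → P? (a + x)) b
count-+ P? zero    b = refl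
count-+ P? (suc a) b with P? 0
... | yes _ = cong suc (count-+ (P? ∘ suc) a b)
... | no _  = count-+ (P? ∘ suc) a b

count-none : (P? : Decidable P) → ∀ m → (∀ x → x < m → ¬ P x) → count P? m ≡ 0
count-none P? zero    ¬P = refl
count-none P? (suc m) ¬P with P? 0
... | yes p = contradiction p (¬P 0 z<s)
... | no _  = count-none (P? ∘ suc) m (λ x → ¬P (suc x) ∘ s<s)

count-complement : (P? : Decidable P) (Q? : Decidable Q) →
                   (∀ x → P x → ¬ Q x) → (∀ x → ¬ P x → Q x) →
                   ∀ m → count P? m + count Q? m ≡ m
count-complement P? Q? P⇒¬Q ¬P⇒Q zero = refl
count-complement P? Q? P⇒¬Q ¬P⇒Q (suc m) with P? 0 | Q? 0
... | yes p | yes q = contradiction q (P⇒¬Q 0 p)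
... | yes _ | no _  = cong suc rest
  where rest = count-complement (P? ∘ suc) (Q? ∘ suc) (P⇒¬Q ∘ suc) (¬P⇒Q ∘ suc) m
... | no _  | yes _ = trans (+-suc _ _) (cong suc rest)
  where rest = count-complement (P? ∘ suc) (Q? ∘ suc) (P⇒¬Q ∘ suc) (¬P⇒Q ∘ suc) m
... | no ¬p | no ¬q = contradiction (¬P⇒Q 0 ¬p) ¬q

count-periodic : (P? : Decidable P) → ∀ m → (∀ x → P (m + x) ⇔ P x) →
                 ∀ k → count P? (k * m) ≡ k * count P? m
count-periodic P? m periodic zero    = refl
count-periodic P? m periodic (suc k) = begin
  count P? (m + k * m)                          ≡⟨ count-+ P? m (k * m) ⟩
  count P? m + count (λ x → P? (m + x)) (k * m) ≡⟨ cong (count P? m +_) (count-cong _ P? (k * m) (λ x _ → periodic x)) ⟩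
  count P? m + count P? (k * m)                 ≡⟨ cong (count P? m +_) (count-periodic P? m periodic k) ⟩
  count P? m + k * count P? m                   ∎
  where open ≡-Reasoning

count-multiples : {P : Pred ℕ ℓ} (P? : Decidable P) → ∀ q .{{_ : NonZero q}} → (∀ x → P x → q ∣ x) →
                  ∀ b → count P? (b * q) ≡ count (λ z → P? (z * q)) b
count-multiples P? (suc _) _ zero = refl
count-multiples {P = P} P? q@(suc q′) onMultiples (suc b) = begin
  count P? (q + b * q)                          ≡⟨ count-+ P? q (b * q) ⟩
  count P? q + count (λ x → P? (q + x)) (b * q) ≡⟨ cong₂ _+_ firstBlock (count-multiples (λ x → P? (q + x)) q shifted b) ⟩
  count (λ z → P? (z * q)) 1 + count (λ z → P? (q + z * q)) b ≡⟨ count-+ (λ z → P? (z * q)) 1 b ⟨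
  count (λ z → P? (z * q)) (suc b)              ∎
  where
  open ≡-Reasoning
  shifted : ∀ x → P (q + x) → q ∣ x
  shifted x P[q+x] = ∣m+n∣m⇒∣n (onMultiples (q + x) P[q+x]) ∣-refl
  none-below-q : ∀ x → x < q′ → ¬ P (suc x)
  none-below-q x x<q′ P[1+x] = <⇒≱ (s<s x<q′) (∣⇒≤ (onMultiples (suc x) P[1+x]))
  firstBlock : count P? q ≡ count (λ z → P? (z * q)) 1
  firstBlock = begin
    count P? (1 + q′)                   ≡⟨ count-+ P? 1 q′ ⟩
    count P? 1 + count (P? ∘ suc) q′    ≡⟨ cong (count P? 1 +_) (count-none (P? ∘ suc) q′ none-below-q) ⟩
    count P? 1 + 0                      ≡⟨ +-identityʳ _ ⟩
    count P? 1                          ≡⟨ count-1-cong P? (λ z → P? (z * q)) ⇔.refl ⟩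
    count (λ z → P? (z * q)) 1          ∎

count-shift : {P : Pred ℕ ℓ} (P? : Decidable P) → ∀ m → P 0 ⇔ P m → count (P? ∘ suc) m ≡ count P? m
count-shift {P = P} P? m P0⇔Pm = +-cancelˡ-≡ (count P? 1) _ _ (begin
  count P? 1 + count (P? ∘ suc) m         ≡⟨ count-+ P? 1 m ⟨
  count P? (1 + m)                        ≡⟨ cong (count P?) (+-comm 1 m) ⟩
  count P? (m + 1)                        ≡⟨ count-+ P? m 1 ⟩
  count P? m + count (λ x → P? (m + x)) 1 ≡⟨ cong (count P? m +_) (count-1-cong (λ x → P? (m + x)) P? P[m+0]⇔P[0]) ⟩
  count P? m + count P? 1                 ≡⟨ +-comm (count P? m) _ ⟩
  count P? 1 + count P? m                 ∎)
  where
  open ≡-Reasoning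
  P[m+0]⇔P[0] : P (m + 0) ⇔ P 0
  P[m+0]⇔P[0] = subst (λ y → P y ⇔ P 0) (sym (+-identityʳ m)) (⇔.sym P0⇔Pm)

length-filter-tabulate : ∀ {a} {A : Set a} {R : Pred A ℓ′} (R? : Decidable R) (P? : Decidable P) →
                         ∀ {m} (f : Fin m → A) → (∀ k → R (f k) ⇔ P (toℕ k)) →
                         length (filter R? (tabulate f)) ≡ count P? m
length-filter-tabulate R? P? {zero}  f R⇔P = refl
length-filter-tabulate R? P? {suc m} f R⇔P with R? (f zero) | P? 0
... | yes _ | yes _ = cong suc (length-filter-tabulate R? (P? ∘ suc) (f ∘ suc) (R⇔P ∘ suc))
... | yes r | no ¬p = contradiction (to (R⇔P zero) r) ¬p
... | no ¬r | yes p = contradiction (from (R⇔P zero) p) ¬r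
... | no _  | no _  = length-filter-tabulate R? (P? ∘ suc) (f ∘ suc) (R⇔P ∘ suc)

∣p∣≡count : ∀ {m} (W : Subset m) (P? : Decidable P) → (∀ x → x ∈ W ⇔ P (toℕ x)) → ∣ W ∣ ≡ count P? m
∣p∣≡count Vec.[]              P? W⇔P = refl
∣p∣≡count (inside Vec.∷ W)  P? W⇔P with P? 0
... | yes _ = cong suc (∣p∣≡count W (P? ∘ suc) (λ x → ⇔.trans (mk⇔ Vec.there drop-there) (W⇔P (suc x))))
... | no ¬p = contradiction (to (W⇔P zero) Vec.here) ¬p
∣p∣≡count (outside Vec.∷ W) P? W⇔P with P? 0
... | yes p = contradiction (from (W⇔P zero) p) λ ()
... | no _  = ∣p∣≡count W (P? ∘ suc) (λ x → ⇔.trans (mk⇔ Vec.there drop-there) (W⇔P (suc x)))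

x∈⋃⇔Any : ∀ {n} {x : Fin n} (ps : List (Subset n)) → x ∈ ⋃ ps ⇔ Any (x ∈_) ps
x∈⋃⇔Any []       = mk⇔ (λ x∈⊥ → contradiction x∈⊥ ∉⊥) λ ()
x∈⋃⇔Any (p ∷ ps) = mk⇔
  (λ x∈p∪⋃ps → [ here , there ∘ to (x∈⋃⇔Any ps) ]′ (x∈p∪q⁻ p (⋃ ps) x∈p∪⋃ps))
  (λ { (here x∈p)     → x∈p∪q⁺ (inj₁ x∈p)
      ; (there x∈⋃ps) → x∈p∪q⁺ (inj₂ (from (x∈⋃⇔Any ps) x∈⋃ps)) })

Any-⇔ : ∀ {a} {A : Set a} {P Q : Pred A ℓ} {xs : List A} → All (λ x → P x ⇔ Q x) xs → Any P xs ⇔ Any Q xs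
Any-⇔ All.[]           = mk⇔ (λ ()) (λ ())
Any-⇔ (P⇔Q All.∷ rest) = mk⇔
  (λ { (here px) → here (to P⇔Q px) ; (there pxs) → there (to (Any-⇔ rest) pxs) })
  (λ { (here qx) → here (from P⇔Q qx) ; (there qxs) → there (from (Any-⇔ rest) qxs) })

m∣m^n : ∀ {m n} → n ≥ 1 → m ∣ m ^ n
m∣m^n {m} {suc n} _ = m∣m*n (m ^ n)

div-exact : ∀ {n q d} .{{_ : NonZero n}} → n ≡ q * d → n div d ≡ q
div-exact {n} {q} {zero}  n≡q*0 = contradiction (trans n≡q*0 (*-zeroʳ q)) (≢-nonZero⁻¹ n)
div-exact {q = q} {suc d} refl  = m*n/n≡m q (suc d)

div-*-inverse : ∀ {m n} → n ∣ m → m div n * n ≡ m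
div-*-inverse {n = zero}  0∣m = sym (0∣⇒≡0 0∣m)
div-*-inverse {n = suc n} n∣m = m/n*n≡m n∣m

div-div : ∀ {n d} .{{_ : NonZero n}} → d ∣ n → n div (n div d) ≡ d
div-div {n} {d} (divides c n≡c*d) =
  trans (cong (n div_) (div-exact {q = c} n≡c*d)) (div-exact {q = d} (trans n≡c*d (*-comm c d)))

does≡true⇔ : ∀ {a} {A : Set a} (a? : Dec A) → does a? ≡ true ⇔ A
does≡true⇔ (yes a) = mk⇔ (λ _ → a) (λ _ → refl)
does≡true⇔ (no ¬a) = mk⇔ (λ ()) (λ a → contradiction a ¬a)

x∈S⇔ : ∀ {n d} .{{_ : NonZero n}} (x : Fin n) → d ∣ n → x ∈ S n (n div d) ⇔ d ∣ toℕ x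
x∈S⇔ {n} {d} x d∣n = begin
  x ∈ S n (n div d)                           ∼⟨ mk⇔ []=⇒lookup (lookup⇒[]= x _) ⟩
  (lookup (S n (n div d)) x ≡ true)           ≡⟨ cong (_≡ true) (lookup∘tabulate _ x) ⟩
  (does (n div (n div d) ∣? toℕ x) ≡ true)    ∼⟨ does≡true⇔ (n div (n div d) ∣? toℕ x) ⟩
  (n div (n div d) ∣ toℕ x)                   ≡⟨ cong (_∣ toℕ x) (div-div {d = d} d∣n) ⟩
  (d ∣ toℕ x)                                 ∎
  where open EquationalReasoning {k = equivalence}

∣⋃S∣≡count : ∀ {a} {A : Set a} {n} .{{_ : NonZero n}} (d : A → ℕ) (xs : List A) → All (λ i → d i ∣ n) xs →
             ∣ ⋃ (map (λ i → S n (n div d i)) xs) ∣ ≡ count (λ z → any? (λ i → d i ∣? z) xs) n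
∣⋃S∣≡count d xs d∣n = ∣p∣≡count _ _ λ x →
  ⇔.trans (x∈⋃⇔Any _) (⇔.trans (mk⇔ Any.map⁻ Any.map⁺) (Any-⇔ (All.map (x∈S⇔ x) d∣n)))

module _ {r} (f : Fin r → ℕ) where

  ∏-pres-∣ : {g : Fin r → ℕ} → (∀ i → f i ∣ g i) → ∀ I → ∏[ f ∈ I ] ∣ ∏[ g ∈ I ]
  ∏-pres-∣ {g} f∣g I = go (filter (_∈? I) (allFin r))
    where
    go : ∀ xs → product (map f xs) ∣ product (map g xs)
    go []       = ∣-refl
    go (x ∷ xs) = *-pres-∣ (f∣g x) (go xs)

  ∏-nonZero : (∀ i → NonZero (f i)) → ∀ I → NonZero ∏[ f ∈ I ]
  ∏-nonZero f≢0 I = product≢0 (All.map⁺ (All.universal f≢0 (filter (_∈? I) (allFin r))))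

  ∏-partition : {I J K : Subset r} → (∀ x → x ∈ I ⇔ (x ∈ J ⊎ x ∈ K)) → (∀ x → x ∈ J → x ∉ K) →
                ∏[ f ∈ I ] ≡ ∏[ f ∈ J ] * ∏[ f ∈ K ]
  ∏-partition {I} {J} {K} I⇔J⊎K disjoint = go (allFin r)
    where
    ∏ : Subset r → List (Fin r) → ℕ
    ∏ L xs = product (map f (filter (_∈? L) xs))
    go : ∀ xs → ∏ I xs ≡ ∏ J xs * ∏ K xs
    go []       = refl
    go (x ∷ xs) with x ∈? I | x ∈? J | x ∈? K
    ... | _      | yes x∈J | yes x∈K = contradiction x∈K (disjoint x x∈J)
    ... | yes _  | yes _   | no _    = trans (cong (f x *_) (go xs)) (sym (*-assoc (f x) _ _))
    ... | yes _  | no _    | yes _   = trans (cong (f x *_) (go xs)) (x∙yz≈y∙xz (f x) (∏ J xs) (∏ K xs))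
    ... | yes x∈I | no x∉J | no x∉K  = contradiction (to (I⇔J⊎K x) x∈I) [ x∉J , x∉K ]′
    ... | no x∉I | yes x∈J | no _    = contradiction (from (I⇔J⊎K x) (inj₁ x∈J)) x∉I
    ... | no x∉I | no _    | yes x∈K = contradiction (from (I⇔J⊎K x) (inj₂ x∈K)) x∉I
    ... | no _   | no _    | no _    = go xs

  ∏-∪ : {I J : Subset r} → (∀ x → x ∈ I → x ∉ J) → ∏[ f ∈ I ∪ J ] ≡ ∏[ f ∈ I ] * ∏[ f ∈ J ]
  ∏-∪ {I} {J} = ∏-partition (λ x → mk⇔ (x∈p∪q⁻ I J) x∈p∪q⁺)

  ∏-⊤ : (I : Subset r) → ∏[ f ∈ ⊤ ] ≡ ∏[ f ∈ I ] * ∏[ f ∈ ∁ I ]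
  ∏-⊤ I = ∏-partition (λ x → mk⇔ (λ _ → Sum.map₂ x∉p⇒x∈∁p (toSum (x ∈? I))) (λ _ → ∈⊤))
                      (λ x x∈I x∈∁I → x∈∁p⇒x∉p x∈∁I x∈I)

filter-∈?-∷-suc : ∀ {r} s (p : Subset r) xs → filter (_∈? (s Vec.∷ p)) (map suc xs) ≡ map suc (filter (_∈? p) xs)
filter-∈?-∷-suc s p []       = refl
filter-∈?-∷-suc s p (x ∷ xs) with does (x ∈? p)
... | true  = cong (suc x ∷_) (filter-∈?-∷-suc s p xs)
... | false = filter-∈?-∷-suc s p xs

filter-∈⁅⁆ : ∀ {r} (a : Fin r) → filter (_∈? ⁅ a ⁆) (allFin r) ≡ a ∷ []
filter-∈⁅⁆ {suc r} zero    = cong (zero ∷_) (begin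
  filter (_∈? ⁅ zero ⁆) (tabulate suc)      ≡⟨ cong (filter _) (map-tabulate id suc) ⟨
  filter (_∈? ⁅ zero ⁆) (map suc (allFin r)) ≡⟨ filter-∈?-∷-suc inside ⊥ (allFin r) ⟩
  map suc (filter (_∈? ⊥) (allFin r))       ≡⟨ cong (map suc) (filter-none (_∈? ⊥) (All.universal (λ _ → ∉⊥) (allFin r))) ⟩
  []                                         ∎)
  where open ≡-Reasoning
filter-∈⁅⁆ {suc r} (suc a) = begin
  filter (_∈? ⁅ suc a ⁆) (tabulate suc)       ≡⟨ cong (filter _) (map-tabulate id suc) ⟨
  filter (_∈? ⁅ suc a ⁆) (map suc (allFin r)) ≡⟨ filter-∈?-∷-suc outside ⁅ a ⁆ (allFin r) ⟩
  map suc (filter (_∈? ⁅ a ⁆) (allFin r))     ≡⟨ cong (map suc) (filter-∈⁅⁆ a) ⟩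
  suc a ∷ []                                   ∎
  where open ≡-Reasoning

∏-⁅⁆ : ∀ {r} (f : Fin r → ℕ) (a : Fin r) → ∏[ f ∈ ⁅ a ⁆ ] ≡ f a
∏-⁅⁆ f a = trans (cong (product ∘ map f) (filter-∈⁅⁆ a)) (*-identityʳ (f a))

∏-⊤-split : ∀ {r} (f : Fin r → ℕ) {I : Subset r} {a : Fin r} → a ∉ I →
            ∏[ f ∈ ⊤ ] ≡ ∏[ f ∈ I ] * f a * ∏[ f ∈ ∁ (I ∪ ⁅ a ⁆) ]
∏-⊤-split f {I} {a} a∉I = trans (∏-⊤ f (I ∪ ⁅ a ⁆))
  (cong (_* ∏[ f ∈ ∁ (I ∪ ⁅ a ⁆) ]) (trans (∏-∪ f a∉⁅⁆) (cong (∏[ f ∈ I ] *_) (∏-⁅⁆ f a))))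
  where
  a∉⁅⁆ : ∀ x → x ∈ I → x ∉ ⁅ a ⁆
  a∉⁅⁆ x x∈I x∈⁅a⁆ = a∉I (subst (_∈ I) (x∈⁅y⁆⇒x≡y a x∈⁅a⁆) x∈I)

coprime-* : ∀ {m n o} → Coprime m n → Coprime m o → Coprime m (n * o)
coprime-* {m} {n} c[m,n] c[m,o] (d∣m , d∣n*o) = c[m,o] (d∣m , coprime-divisor c[d,n] d∣n*o)
  where
  c[d,n] : Coprime _ n
  c[d,n] (e∣d , e∣n) = c[m,n] (∣-trans e∣d d∣m , e∣n)

∤⇒coprime : ∀ {m p} → Prime p → ¬ p ∣ m → Coprime m p
∤⇒coprime pr p∤m (d∣m , d∣p) with prime⇒irreducible pr d∣p
... | inj₁ d≡1 = d≡1
... | inj₂ refl = contradiction d∣m p∤m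

coprime[0,m]⇔coprime[m,m] : ∀ {m} → Coprime 0 m ⇔ Coprime m m
coprime[0,m]⇔coprime[m,m] = mk⇔ (λ c {d} (d∣m , _) → c (d ∣0 , d∣m)) (λ c {_} (_ , d∣m) → c (d∣m , d∣m))

φ≡count-coprime : ∀ m → φ m ≡ count (λ z → coprime? z m) m
φ≡count-coprime m = trans
  (length-filter-tabulate (λ k → gcd (suc (toℕ k)) m ≟ 1) (λ z → coprime? (suc z) m) {m} id
                          (λ _ → mk⇔ gcd≡1⇒coprime coprime⇒gcd≡1))
  (count-shift (λ z → coprime? z m) m coprime[0,m]⇔coprime[m,m])

module _ {a} {A : Set a} (p : A → ℕ) (prime : ∀ i → Prime (p i)) where

  ¬any∣⇒coprime : ∀ {m} xs → ¬ Any (λ i → p i ∣ m) xs → Coprime m (product (map p xs))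
  ¬any∣⇒coprime []       _    (_ , d∣1) = ∣1⇒≡1 d∣1
  ¬any∣⇒coprime (i ∷ xs) ¬any =
    coprime-* (∤⇒coprime (prime i) (¬any ∘ here)) (¬any∣⇒coprime xs (¬any ∘ there))

  any∣⇒¬coprime : ∀ {m} xs → Any (λ i → p i ∣ m) xs → ¬ Coprime m (product (map p xs))
  any∣⇒¬coprime (i ∷ xs) (here pᵢ∣m) coprime = ¬prime[1] (subst Prime (coprime (pᵢ∣m , m∣m*n _)) (prime i))
  any∣⇒¬coprime (i ∷ xs) (there any) coprime =
    any∣⇒¬coprime xs any (λ (d∣m , d∣rest) → coprime (d∣m , ∣n⇒∣m*n (p i) d∣rest))

  count-any∣ : ∀ xs → let M = product (map p xs) in
               count (λ z → any? (λ i → p i ∣? z) xs) M ≡ M ∸ φ M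
  count-any∣ xs = begin
    count A? M                          ≡⟨ m+n∸n≡m (count A? M) (count C? M) ⟨
    count A? M + count C? M ∸ count C? M ≡⟨ cong₂ _∸_ complement (sym (φ≡count-coprime M)) ⟩
    M ∸ φ M                             ∎
    where
    open ≡-Reasoning
    M = product (map p xs)
    A? = λ z → any? (λ i → p i ∣? z) xs
    C? = λ z → coprime? z M
    complement : count A? M + count C? M ≡ M
    complement = count-complement A? C? (λ _ → any∣⇒¬coprime xs) (λ _ → ¬any∣⇒coprime xs) M

  count-any-*∣ : ∀ xs q .{{_ : NonZero q}} k → let M = product (map p xs) in
                 count (λ z → any? (λ i → p i * q ∣? z) xs) (k * (M * q)) ≡ k * (M ∸ φ M)
  count-any-*∣ xs q k = begin
    count D? (k * (M * q))          ≡⟨ count-periodic D? (M * q) periodic k ⟩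
    k * count D? (M * q)            ≡⟨ cong (k *_) (count-multiples D? q onMultiples M) ⟩
    k * count (λ z → D? (z * q)) M  ≡⟨ cong (k *_) (count-cong (λ z → D? (z * q)) A? M (λ z _ → cancel z)) ⟩
    k * count A? M                  ≡⟨ cong (k *_) (count-any∣ xs) ⟩
    k * (M ∸ φ M)                   ∎
    where
    open ≡-Reasoning
    M = product (map p xs)
    D? = λ z → any? (λ i → p i * q ∣? z) xs
    A? = λ z → any? (λ i → p i ∣? z) xs
    periodic : ∀ x → Any (λ i → p i * q ∣ M * q + x) xs ⇔ Any (λ i → p i * q ∣ x) xs
    periodic x = Any-⇔ (All.tabulate λ {i} i∈xs →
      let pᵢq∣Mq = *-monoˡ-∣ q (∈⇒∣product (∈-map⁺ p i∈xs)) in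
      mk⇔ (λ h → ∣m+n∣m⇒∣n h pᵢq∣Mq) (∣m∣n⇒∣m+n pᵢq∣Mq))
    onMultiples : ∀ x → Any (λ i → p i * q ∣ x) xs → q ∣ x
    onMultiples x any with (i , pᵢq∣x) ← Any.satisfied any = ∣-trans (n∣m*n (p i)) pᵢq∣x
    cancel : ∀ z → Any (λ i → p i * q ∣ z * q) xs ⇔ Any (λ i → p i ∣ z) xs
    cancel z = mk⇔ (Any.map (*-cancelʳ-∣ q)) (Any.map (*-monoˡ-∣ q))

lemma2p8 : (r : ℕ) (p e : Fin r → ℕ) →
           (∀ i → Prime (p i)) →
           (∀ i j → i Data.Fin.< j → p i Data.Nat.< p j) →
           (∀ i → e i ≥ 1) →
           (n : ℕ) → n ≡ ∏[ (λ i → p i ^ e i) ∈ ⊤ ] →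
           (I₁ : Subset r) → Nonempty I₁ → I₁ ⊂ ⊤ →
           (a : Fin r) → a ∉ I₁ →
           (I₂ : Subset r) → I₂ ≡ ∁ (I₁ ∪ ⁅ a ⁆) →
           (K : Subset n) → K ≡ ⋃[ (λ i → S n (n div (p i * p a))) ∈ I₁ ] →
           ∣ K ∣ ≡ (n div ∏[ p ∈ ⊤ ]) * ∏[ p ∈ I₂ ] * (∏[ p ∈ I₁ ] ∸ φ ∏[ p ∈ I₁ ])
lemma2p8 r p e prime _ e≥1 n n≡∏ I₁ _ _ a a∉I₁ I₂ refl K refl = begin
  ∣ K ∣                    ≡⟨ ∣⋃S∣≡count {{n≢0}} (λ i → p i * p a) D pᵢpₐ∣n ⟩
  count D? n               ≡⟨ cong (count D?) n≡k*[M*pₐ] ⟩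
  count D? (k * (M * p a)) ≡⟨ count-any-*∣ p prime D (p a) {{prime⇒nonZero (prime a)}} k ⟩
  k * (M ∸ φ M)            ∎
  where
  open ≡-Reasoning
  D = filter (_∈? I₁) (allFin r)
  D? = λ z → any? (λ i → p i * p a ∣? z) D
  M = ∏[ p ∈ I₁ ]
  rad = ∏[ p ∈ ⊤ ]
  k = n div rad * ∏[ p ∈ I₂ ]
  n≢0 : NonZero n
  n≢0 = subst NonZero (sym n≡∏) (∏-nonZero _ (λ i → m^n≢0 (p i) (e i) {{prime⇒nonZero (prime i)}}) ⊤)
  rad∣n : rad ∣ n
  rad∣n = subst (rad ∣_) (sym n≡∏) (∏-pres-∣ p (λ i → m∣m^n (e≥1 i)) ⊤)
  rad≡M*pₐ*P₂ : rad ≡ M * p a * ∏[ p ∈ I₂ ]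
  rad≡M*pₐ*P₂ = ∏-⊤-split p a∉I₁
  n≡k*[M*pₐ] : n ≡ k * (M * p a)
  n≡k*[M*pₐ] = begin
    n                                         ≡⟨ div-*-inverse rad∣n ⟨
    n div rad * rad                           ≡⟨ cong (n div rad *_) (trans rad≡M*pₐ*P₂ (*-comm (M * p a) _)) ⟩
    n div rad * (∏[ p ∈ I₂ ] * (M * p a))     ≡⟨ *-assoc (n div rad) _ _ ⟨
    k * (M * p a)                             ∎
  pᵢpₐ∣n : All (λ i → p i * p a ∣ n) D
  pᵢpₐ∣n = All.tabulate λ i∈D → ∣-trans (*-monoˡ-∣ (p a) (∈⇒∣product (∈-map⁺ p i∈D)))
             (∣-trans (subst (M * p a ∣_) (sym rad≡M*pₐ*P₂) (m∣m*n _)) rad∣n)
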